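{- Let $A$, $B$ and $M$ be matroids and let $N=A\oplus B$. If $P$ is a tensor product of $M$ and $N$, then $P=P_A\oplus P_B$, where $P_A=P|_{E(M)\times E(A)}$ is a tensor product of $M$ and $A$ and $P_B=P|_{E(M)\times E(B)}$ is a tensor product of $M$ and $B$.
   Context: For matroids $M,N$, a matroid $P$ on $E(M)\times E(N)$ is a quasi product of $M$ and $N$ if: for every non-loop $e\in E(M)$, $x\mapsto(e,x)$ is an isomorphism $N\cong P|_{\{e\}\times E(N)}$; for every non-loop $f\in E(N)$, $x\mapsto(x,f)$ is an isomorphism $M\cong P|_{E(M)\times\{f\}}$; for loops $e$ of $M$ (resp. $f$ of $N$), $P|_{\{e\}\times E(N)}$ (resp. $P|_{E(M)\times\{f\}}$) has rank $0$. A tensor product of $M$ and $N$ is a quasi product with $\mathrm{rk}(P)=\mathrm{rk}(M)\mathrm{rk}(N)$. -}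

module Defs where

open import Data.Nat using (ℕ; _+_; _*_; _≤_)
open import Data.Fin using (Fin; _≟_; combine; remQuot; _↑ˡ_; _↑ʳ_)
open import Data.Fin.Properties using (any?)
open import Data.Fin.Subset using (Subset; _⊆_; _∪_; _∩_; ∣_∣; ⁅_⁆; ⊤; _∈_)
open import Data.Fin.Subset.Properties using (_∈?_)
open import Data.Vec using (tabulate; lookup)
open import Data.Product using (_×_; Σ; proj₁; proj₂)
open import Relation.Nullary using (¬_; does)
open import Relation.Nullary.Decidable using (_×-dec_)
open import Relation.Binary.PropositionalEquality using (_≡_)

record Matroid (n : ℕ) : Set where
  field
    rk       : Subset n → ℕ
    rk-bound : ∀ S → rk S ≤ ∣ S ∣
    rk-mono  : ∀ S T → S ⊆ T → rk S ≤ rk T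
    rk-submod : ∀ S T → rk (S ∪ T) + rk (S ∩ T) ≤ rk S + rk T
open Matroid public

rank : ∀ {n} → Matroid n → ℕ
rank M = rk M ⊤

IsLoop : ∀ {n} → Matroid n → Fin n → Set
IsLoop M e = rk M ⁅ e ⁆ ≡ 0

image : ∀ {a b} → (Fin a → Fin b) → Subset a → Subset b
image f S = tabulate (λ y → does (any? (λ x → (x ∈? S) ×-dec (f x ≟ y))))

preimage : ∀ {a b} → (Fin a → Fin b) → Subset b → Subset a
preimage f S = tabulate (λ x → lookup S (f x))

-- E(M) × E(N) is represented by Fin (m * n), with (e , x) ↦ combine e x.
-- Quasi product of M and N (P a matroid on E(M) × E(N)).
-- "x ↦ (e,x) is an isomorphism N ≅ P|_{{e}×E(N)}" : since this map is a
-- bijection of E(N) onto {e}×E(N), it says rk_P(image S) = rk_N(S) for all S.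
IsQuasiProduct : ∀ {m n} → Matroid m → Matroid n → Matroid (m * n) → Set
IsQuasiProduct {m} {n} M N P =
  (∀ (e : Fin m) → ¬ IsLoop M e → ∀ (S : Subset n) →
      rk P (image (λ x → combine e x) S) ≡ rk N S)
  × (∀ (f : Fin n) → ¬ IsLoop N f → ∀ (S : Subset m) →
      rk P (image (λ x → combine {m} {n} x f) S) ≡ rk M S)
  × (∀ (e : Fin m) → IsLoop M e → rk P (image (λ x → combine e x) ⊤) ≡ 0)
  × (∀ (f : Fin n) → IsLoop N f → rk P (image (λ x → combine {m} {n} x f) ⊤) ≡ 0)

IsTensorProduct : ∀ {m n} → Matroid m → Matroid n → Matroid (m * n) → Set
IsTensorProduct M N P = IsQuasiProduct M N P × (rank P ≡ rank M * rank N)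

-- N = A ⊕ B, where E(N) = Fin (a + b) = E(A) ⊔ E(B) via _↑ˡ_ and _↑ʳ_.
IsDirectSum : ∀ {a b} → Matroid (a + b) → Matroid a → Matroid b → Set
IsDirectSum {a} {b} N A B =
  ∀ (S : Subset (a + b)) →
    rk N S ≡ rk A (preimage (λ x → x ↑ˡ b) S) + rk B (preimage (λ y → a ↑ʳ y) S)

-- the embeddings E(M)×E(A) → E(M)×E(N) and E(M)×E(B) → E(M)×E(N)
ιA : ∀ {m} a b → Fin (m * a) → Fin (m * (a + b))
ιA {m} a b k = combine {m} (proj₁ (remQuot {m} a k)) (proj₂ (remQuot {m} a k) ↑ˡ b)

ιB : ∀ {m} a b → Fin (m * b) → Fin (m * (a + b))
ιB {m} a b k = combine {m} (proj₁ (remQuot {m} b k)) (a ↑ʳ proj₂ (remQuot {m} b k))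

IsRestrictionAlong : ∀ {k l} → Matroid l → (Fin k → Fin l) → Matroid k → Set
IsRestrictionAlong P ι Q = ∀ S → rk Q S ≡ rk P (image ι S)

IsDirectSumAlong : ∀ {k₁ k₂ l} → Matroid l →
  (Fin k₁ → Fin l) → Matroid k₁ → (Fin k₂ → Fin l) → Matroid k₂ → Set
IsDirectSumAlong P ι₁ Q₁ ι₂ Q₂ =
  ∀ S → rk P S ≡ rk Q₁ (preimage ι₁ S) + rk Q₂ (preimage ι₂ S)

-- Let Q be a quasi product of M and N.  Growing a set R of rows one element at a time shows
-- rk_Q(R × E(N)) ≤ rk_M(R) · rk(N): a new row e adds at most rk(N), and nothing at all when e
-- is spanned by R, because then each column (R ∪ e) × {f} has the rank of R × {f} and
-- submodularity absorbs it.  The restrictions P_A, P_B are quasi products since N|E(A) = A and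
-- N|E(B) = B, so rk(P_A) ≤ rk(M)rk(A) and rk(P_B) ≤ rk(M)rk(B).  They cover P, whose rank is
-- rk(M)(rk(A) + rk(B)); hence both bounds are tight, rk(P) = rk(P_A) + rk(P_B), and by
-- submodularity rk_P is additive over the cover, i.e. P = P_A ⊕ P_B.
module Submission where

open import Defs
open import Data.Bool using (Bool; true)
open import Data.Empty using (⊥-elim)
open import Data.Fin using (Fin; zero; suc; _≟_; combine; quotient; remainder;
  _↑ˡ_; _↑ʳ_; splitAt)
open import Data.Fin.Properties using (any?; remQuot-combine; combine-remQuot;
  ↑ˡ-injective; ↑ʳ-injective; splitAt-↑ˡ; splitAt-↑ʳ; splitAt⁻¹-↑ˡ; splitAt⁻¹-↑ʳ)
open import Data.Fin.Subset using (Subset; _⊆_; _∪_; _∩_; ∣_∣; ⁅_⁆; ⊤; ⊥; _∈_; _∉_;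
  inside; outside)
open import Data.Fin.Subset.Properties using (_∈?_; ∈⊤; ∉⊥; ⊥⊆; ⊆-antisym; drop-there;
  x∈⁅x⁆; x∈⁅y⁆⇒x≡y; ∣⊥∣≡0; ∣⁅x⁆∣≡1; x∈p∪q⁺; x∈p∪q⁻; q⊆p∪q; x∈p∩q⁺; x∈p∩q⁻; p⊂q⇒∣p∣<∣q∣;
  ∪-identityˡ)
open import Data.Nat using (ℕ; suc; _+_; _*_; _≤_; _<_; z≤n; _≤?_)
  renaming (_≟_ to _≟ℕ_)
open import Data.Nat.Properties using (≤-reflexive; ≤-trans; ≤-antisym; ≰⇒>;
  +-mono-≤; +-monoˡ-≤; +-monoʳ-≤; +-cancelˡ-≤; +-cancelʳ-≤; +-comm; +-assoc;
  +-identityʳ; m≤m+n; *-monoˡ-≤; *-distribˡ-+; n≤0⇒n≡0; module ≤-Reasoning)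
open import Data.Product using (_×_; _,_; proj₁; proj₂; ∃; Σ-syntax)
open import Data.Sum using (inj₁; inj₂; [_,_]′)
open import Data.Vec using (_∷_; []; tabulate)
open import Data.Vec.Properties using (lookup∘tabulate; []=⇒lookup; lookup⇒[]=)
open import Function using (_∘_)
open import Function.Definitions using (Injective)
open import Relation.Nullary using (¬_; yes; no)
open import Relation.Nullary.Decidable using (_×-dec_; dec-true)
open import Relation.Binary.PropositionalEquality using (_≡_; _≢_; refl; sym; trans;
  cong; cong₂; subst; module ≡-Reasoning)

private
  variable
    k l m n : ℕ

-- Images, preimages and induction on subsets

∈-tabulate⁺ : {p : Fin n → Bool} {x : Fin n} → p x ≡ true → x ∈ tabulate p
∈-tabulate⁺ {p = p} {x} px = lookup⇒[]= x (tabulate p) (trans (lookup∘tabulate p x) px)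

∈-tabulate⁻ : {p : Fin n → Bool} {x : Fin n} → x ∈ tabulate p → p x ≡ true
∈-tabulate⁻ {p = p} {x} x∈ = trans (sym (lookup∘tabulate p x)) ([]=⇒lookup x∈)

module _ (f : Fin k → Fin l) where

  ∈-preimage⁺ : ∀ {S x} → f x ∈ S → x ∈ preimage f S
  ∈-preimage⁺ = ∈-tabulate⁺ ∘ []=⇒lookup

  ∈-preimage⁻ : ∀ {S x} → x ∈ preimage f S → f x ∈ S
  ∈-preimage⁻ {S} {x} = lookup⇒[]= (f x) S ∘ ∈-tabulate⁻

  ∈-image⁺ : ∀ {S x y} → x ∈ S → f x ≡ y → y ∈ image f S
  ∈-image⁺ {S} {y = y} x∈S fx≡y =
    ∈-tabulate⁺ (dec-true (any? (λ x → (x ∈? S) ×-dec (f x ≟ y))) (_ , x∈S , fx≡y))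

  ∈-image⁻ : ∀ {S y} → y ∈ image f S → ∃ λ x → x ∈ S × f x ≡ y
  ∈-image⁻ {S} {y} y∈ with any? (λ x → (x ∈? S) ×-dec (f x ≟ y)) | ∈-tabulate⁻ y∈
  ... | yes witness | _ = witness

  image-mono : ∀ {S T} → S ⊆ T → image f S ⊆ image f T
  image-mono S⊆T y∈ with ∈-image⁻ y∈
  ... | x , x∈S , refl = ∈-image⁺ (S⊆T x∈S) refl

  image-∪ : ∀ S T → image f (S ∪ T) ⊆ image f S ∪ image f T
  image-∪ S T y∈ with ∈-image⁻ y∈
  ... | x , x∈S∪T , refl with x∈p∪q⁻ S T x∈S∪T
  ...   | inj₁ x∈S = x∈p∪q⁺ (inj₁ (∈-image⁺ x∈S refl))
  ...   | inj₂ x∈T = x∈p∪q⁺ (inj₂ (∈-image⁺ x∈T refl))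

  image-∩ : ∀ S T → image f (S ∩ T) ⊆ image f S ∩ image f T
  image-∩ S T y∈ with ∈-image⁻ y∈
  ... | x , x∈S∩T , refl with x∈p∩q⁻ S T x∈S∩T
  ...   | x∈S , x∈T = x∈p∩q⁺ (∈-image⁺ x∈S refl , ∈-image⁺ x∈T refl)

  image-⊥ : image f ⊥ ⊆ ⊥
  image-⊥ y∈ with ∈-image⁻ y∈
  ... | x , x∈⊥ , _ = ⊥-elim (∉⊥ x∈⊥)

  image-⁅⁆ : ∀ x → image f ⁅ x ⁆ ≡ ⁅ f x ⁆
  image-⁅⁆ x = ⊆-antisym lhs⊆rhs rhs⊆lhs
    where
    lhs⊆rhs : image f ⁅ x ⁆ ⊆ ⁅ f x ⁆
    lhs⊆rhs y∈ with ∈-image⁻ y∈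
    ... | z , z∈⁅x⁆ , refl = subst (λ z → f z ∈ ⁅ f x ⁆) (sym (x∈⁅y⁆⇒x≡y x z∈⁅x⁆)) (x∈⁅x⁆ (f x))
    rhs⊆lhs : ⁅ f x ⁆ ⊆ image f ⁅ x ⁆
    rhs⊆lhs y∈ = ∈-image⁺ (x∈⁅x⁆ x) (sym (x∈⁅y⁆⇒x≡y (f x) y∈))

  image-preimage : ∀ S → image f (preimage f S) ≡ S ∩ image f ⊤
  image-preimage S = ⊆-antisym lhs⊆rhs rhs⊆lhs
    where
    lhs⊆rhs : image f (preimage f S) ⊆ S ∩ image f ⊤
    lhs⊆rhs y∈ with ∈-image⁻ y∈
    ... | x , x∈ , refl = x∈p∩q⁺ (∈-preimage⁻ x∈ , ∈-image⁺ ∈⊤ refl)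
    rhs⊆lhs : S ∩ image f ⊤ ⊆ image f (preimage f S)
    rhs⊆lhs y∈ with x∈p∩q⁻ S _ y∈
    ... | y∈S , y∈img with ∈-image⁻ y∈img
    ...   | x , _ , refl = ∈-image⁺ (∈-preimage⁺ y∈S) refl

  preimage-⊤ : preimage f ⊤ ≡ ⊤
  preimage-⊤ = ⊆-antisym (λ _ → ∈⊤) (λ _ → ∈-preimage⁺ ∈⊤)

  preimage-image : Injective _≡_ _≡_ f → ∀ S → preimage f (image f S) ≡ S
  preimage-image f-inj S = ⊆-antisym lhs⊆rhs (∈-preimage⁺ ∘ λ x∈S → ∈-image⁺ x∈S refl)
    where
    lhs⊆rhs : preimage f (image f S) ⊆ S
    lhs⊆rhs x∈ with ∈-image⁻ (∈-preimage⁻ x∈)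
    ... | z , z∈S , fz≡fx = subst (_∈ S) (f-inj fz≡fx) z∈S

preimage-image-disjoint : (f : Fin k → Fin n) (g : Fin l → Fin n) →
  (∀ x y → f x ≢ g y) → ∀ S → preimage g (image f S) ≡ ⊥
preimage-image-disjoint f g disjoint S = ⊆-antisym lhs⊆rhs ⊥⊆
  where
  lhs⊆rhs : preimage g (image f S) ⊆ ⊥
  lhs⊆rhs {y} y∈ with ∈-image⁻ f (∈-preimage⁻ g y∈)
  ... | x , _ , fx≡gy = ⊥-elim (disjoint x y fx≡gy)

image-image : (g : Fin l → Fin n) (f : Fin k → Fin l) {h : Fin k → Fin n} →
  (∀ x → g (f x) ≡ h x) → ∀ S → image g (image f S) ≡ image h S
image-image g f {h} gf≗h S = ⊆-antisym lhs⊆rhs rhs⊆lhs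
  where
  lhs⊆rhs : image g (image f S) ⊆ image h S
  lhs⊆rhs y∈ with ∈-image⁻ g y∈
  ... | z , z∈ , refl with ∈-image⁻ f z∈
  ...   | x , x∈S , refl = ∈-image⁺ h x∈S (sym (gf≗h x))
  rhs⊆lhs : image h S ⊆ image g (image f S)
  rhs⊆lhs y∈ with ∈-image⁻ h y∈
  ... | x , x∈S , refl = ∈-image⁺ g (∈-image⁺ f x∈S refl) (gf≗h x)

∣p∣<∣⁅x⁆∪p∣ : ∀ {x} {p : Subset n} → x ∉ p → ∣ p ∣ < ∣ ⁅ x ⁆ ∪ p ∣
∣p∣<∣⁅x⁆∪p∣ {x = x} {p} x∉p =
  p⊂q⇒∣p∣<∣q∣ (q⊆p∪q ⁅ x ⁆ p , x , x∈p∪q⁺ (inj₁ (x∈⁅x⁆ x)) , x∉p)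

Subset-induction : (P : Subset n → Set) → P ⊥ →
  (∀ {e S} → e ∉ S → P S → P (⁅ e ⁆ ∪ S)) → ∀ S → P S
Subset-induction P P⊥ step [] = P⊥
Subset-induction P P⊥ step (s ∷ S)
  with Subset-induction (P ∘ (outside ∷_)) P⊥ (λ e∉S → step (e∉S ∘ drop-there)) S
... | P[outside∷S] with s
...   | outside = P[outside∷S]
...   | inside =
  subst (P ∘ (inside ∷_)) (∪-identityˡ S) (step {zero} {outside ∷ S} (λ ()) P[outside∷S])

-- Rank functions

+-tight : ∀ {x y p q} → x ≤ p → y ≤ q → p + q ≤ x + y → x ≡ p × y ≡ q
+-tight {x} {y} {p} {q} x≤p y≤q p+q≤x+y =
    ≤-antisym x≤p (+-cancelʳ-≤ q p x (≤-trans p+q≤x+y (+-monoʳ-≤ x y≤q)))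
  , ≤-antisym y≤q (+-cancelˡ-≤ p q y (≤-trans p+q≤x+y (+-monoˡ-≤ y x≤p)))

module _ (M : Matroid n) where

  rk-⊥ : rk M ⊥ ≡ 0
  rk-⊥ = n≤0⇒n≡0 (subst (rk M ⊥ ≤_) (∣⊥∣≡0 n) (rk-bound M ⊥))

  rk-⊆ : ∀ {S T} → S ⊆ T → rk M S ≤ rk M T
  rk-⊆ = rk-mono M _ _

  rk-∪ : ∀ S T → rk M (S ∪ T) ≤ rk M S + rk M T
  rk-∪ S T = ≤-trans (m≤m+n _ _) (rk-submod M S T)

  rk-⁅⁆ : ∀ x → rk M ⁅ x ⁆ ≤ 1
  rk-⁅⁆ x = subst (rk M ⁅ x ⁆ ≤_) (∣⁅x⁆∣≡1 x) (rk-bound M ⁅ x ⁆)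

  rk-∪-absorb : ∀ {W X Y} → W ⊆ X → W ⊆ Y → rk M Y ≤ rk M W → rk M (X ∪ Y) ≤ rk M X
  rk-∪-absorb {W} {X} {Y} W⊆X W⊆Y Y≤W = +-cancelʳ-≤ (rk M W) _ _ (begin
    rk M (X ∪ Y) + rk M W        ≤⟨ +-monoʳ-≤ (rk M (X ∪ Y)) (rk-⊆ (λ w → x∈p∩q⁺ (W⊆X w , W⊆Y w))) ⟩
    rk M (X ∪ Y) + rk M (X ∩ Y)  ≤⟨ rk-submod M X Y ⟩
    rk M X + rk M Y              ≤⟨ +-monoʳ-≤ (rk M X) Y≤W ⟩
    rk M X + rk M W              ∎)
    where open ≤-Reasoning

  -- X and Y need only cover the ground set; they need not be disjoint.
  rk-separator : ∀ {X Y} → ⊤ ⊆ X ∪ Y → rk M X + rk M Y ≤ rank M →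
    ∀ S → rk M S ≡ rk M (S ∩ X) + rk M (S ∩ Y)
  rk-separator {X} {Y} cover tight S = ≤-antisym (≤-trans (rk-⊆ split) (rk-∪ _ _)) additive
    where
    open ≤-Reasoning
    SX = S ∩ X
    SY = S ∩ Y
    split : S ⊆ SX ∪ SY
    split x∈S with x∈p∪q⁻ X Y (cover ∈⊤)
    ... | inj₁ x∈X = x∈p∪q⁺ (inj₁ (x∈p∩q⁺ (x∈S , x∈X)))
    ... | inj₂ x∈Y = x∈p∪q⁺ (inj₂ (x∈p∩q⁺ (x∈S , x∈Y)))
    spans : ⊤ ⊆ (SX ∪ Y) ∪ X
    spans x∈⊤ with x∈p∪q⁻ X Y (cover x∈⊤)
    ... | inj₁ x∈X = x∈p∪q⁺ (inj₂ x∈X)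
    ... | inj₂ x∈Y = x∈p∪q⁺ (inj₁ (x∈p∪q⁺ (inj₂ x∈Y)))
    meets : SX ⊆ (SX ∪ Y) ∩ X
    meets x∈ = x∈p∩q⁺ (x∈p∪q⁺ (inj₁ x∈) , proj₂ (x∈p∩q⁻ S X x∈))
    grows : SX ∪ Y ⊆ S ∪ Y
    grows x∈ with x∈p∪q⁻ SX Y x∈
    ... | inj₁ x∈SX = x∈p∪q⁺ (inj₁ (proj₁ (x∈p∩q⁻ S X x∈SX)))
    ... | inj₂ x∈Y = x∈p∪q⁺ (inj₂ x∈Y)
    Y+SX : rk M Y + rk M SX ≤ rk M (SX ∪ Y)
    Y+SX = +-cancelˡ-≤ (rk M X) _ _ (begin
      rk M X + (rk M Y + rk M SX)          ≡⟨ sym (+-assoc (rk M X) _ _) ⟩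
      rk M X + rk M Y + rk M SX            ≤⟨ +-monoˡ-≤ (rk M SX) tight ⟩
      rank M + rk M SX                     ≤⟨ +-mono-≤ (rk-⊆ spans) (rk-⊆ meets) ⟩
      rk M ((SX ∪ Y) ∪ X) + rk M ((SX ∪ Y) ∩ X) ≤⟨ rk-submod M (SX ∪ Y) X ⟩
      rk M (SX ∪ Y) + rk M X               ≡⟨ +-comm (rk M (SX ∪ Y)) _ ⟩
      rk M X + rk M (SX ∪ Y)               ∎)
    additive : rk M SX + rk M SY ≤ rk M S
    additive = +-cancelˡ-≤ (rk M Y) _ _ (begin
      rk M Y + (rk M SX + rk M SY)         ≡⟨ sym (+-assoc (rk M Y) _ _) ⟩
      rk M Y + rk M SX + rk M SY           ≤⟨ +-monoˡ-≤ (rk M SY) Y+SX ⟩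
      rk M (SX ∪ Y) + rk M SY              ≤⟨ +-monoˡ-≤ (rk M SY) (rk-⊆ grows) ⟩
      rk M (S ∪ Y) + rk M (S ∩ Y)          ≤⟨ rk-submod M S Y ⟩
      rk M S + rk M Y                      ≡⟨ +-comm (rk M S) _ ⟩
      rk M Y + rk M S                      ∎)

restriction : Matroid l → (Fin k → Fin l) → Matroid k
restriction {l = l} {k = k} P f = record
  { rk        = rk P ∘ image f
  ; rk-bound  = Subset-induction (λ S → rk P (image f S) ≤ ∣ S ∣) empty insert
  ; rk-mono   = λ S T S⊆T → rk-⊆ P (image-mono f S⊆T)
  ; rk-submod = λ S T → ≤-trans
      (+-mono-≤ (rk-⊆ P (image-∪ f S T)) (rk-⊆ P (image-∩ f S T)))
      (rk-submod P (image f S) (image f T))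
  }
  where
  open ≤-Reasoning
  empty : rk P (image f ⊥) ≤ ∣ ⊥ {k} ∣
  empty = ≤-trans (rk-⊆ P (image-⊥ f)) (≤-trans (≤-reflexive (rk-⊥ P)) z≤n)
  insert : ∀ {e S} → e ∉ S → rk P (image f S) ≤ ∣ S ∣ →
    rk P (image f (⁅ e ⁆ ∪ S)) ≤ ∣ ⁅ e ⁆ ∪ S ∣
  insert {e} {S} e∉S ih = begin
    rk P (image f (⁅ e ⁆ ∪ S))            ≤⟨ rk-⊆ P (image-∪ f ⁅ e ⁆ S) ⟩
    rk P (image f ⁅ e ⁆ ∪ image f S)      ≤⟨ rk-∪ P _ _ ⟩
    rk P (image f ⁅ e ⁆) + rk P (image f S) ≡⟨ cong (λ T → rk P T + _) (image-⁅⁆ f e) ⟩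
    rk P ⁅ f e ⁆ + rk P (image f S)       ≤⟨ +-mono-≤ (rk-⁅⁆ P (f e)) ih ⟩
    suc ∣ S ∣                             ≤⟨ ∣p∣<∣⁅x⁆∪p∣ e∉S ⟩
    ∣ ⁅ e ⁆ ∪ S ∣                         ∎

-- Subsets of E(M) × E(N), encoded as Fin (m * n) via combine

opaque
  _⊠_ : Subset m → Subset n → Subset (m * n)
  _⊠_ {m} {n} R C = preimage (quotient {m} n) R ∩ preimage (remainder {m} n) C

  ∈-⊠⁺ : {R : Subset m} {C : Subset n} {x : Fin (m * n)} →
    quotient {m} n x ∈ R → remainder {m} n x ∈ C → x ∈ R ⊠ C
  ∈-⊠⁺ q∈R r∈C = x∈p∩q⁺ (∈-preimage⁺ _ q∈R , ∈-preimage⁺ _ r∈C)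

  ∈-⊠⁻ : (R : Subset m) (C : Subset n) → ∀ {x} → x ∈ R ⊠ C →
    quotient {m} n x ∈ R × remainder {m} n x ∈ C
  ∈-⊠⁻ R C x∈ with x∈p∩q⁻ _ _ x∈
  ... | q∈ , r∈ = ∈-preimage⁻ _ q∈ , ∈-preimage⁻ _ r∈

quotient-combine : (i : Fin m) (j : Fin n) → quotient {m} n (combine i j) ≡ i
quotient-combine {m} {n} i j = cong proj₁ (remQuot-combine {m} {n} i j)

remainder-combine : (i : Fin m) (j : Fin n) → remainder {m} n (combine i j) ≡ j
remainder-combine {m} {n} i j = cong proj₂ (remQuot-combine {m} {n} i j)

combine-∈-⊠⁺ : {R : Subset m} {C : Subset n} {i : Fin m} {j : Fin n} →
  i ∈ R → j ∈ C → combine i j ∈ R ⊠ C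
combine-∈-⊠⁺ {R = R} {C} {i} {j} i∈R j∈C =
  ∈-⊠⁺ (subst (_∈ R) (sym (quotient-combine i j)) i∈R) (subst (_∈ C) (sym (remainder-combine i j)) j∈C)

combine-quotient-remainder : ∀ n (x : Fin (m * n)) → combine (quotient {m} n x) (remainder {m} n x) ≡ x
combine-quotient-remainder {m} n = combine-remQuot {m} n

⊠-mono : {R R′ : Subset m} {C C′ : Subset n} → R ⊆ R′ → C ⊆ C′ → R ⊠ C ⊆ R′ ⊠ C′
⊠-mono {R = R} {C = C} R⊆ C⊆ x∈ with ∈-⊠⁻ R C x∈
... | q∈ , r∈ = ∈-⊠⁺ (R⊆ q∈) (C⊆ r∈)

⊤⊆⊤⊠⊤ : ∀ m n → ⊤ ⊆ ⊤ {m} ⊠ ⊤ {n}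
⊤⊆⊤⊠⊤ m n _ = ∈-⊠⁺ {R = ⊤ {m}} {C = ⊤ {n}} ∈⊤ ∈⊤

⊥⊠ : {C : Subset n} → ⊥ {m} ⊠ C ⊆ ⊥
⊥⊠ {m = m} {C = C} x∈ = ⊥-elim (∉⊥ (proj₁ (∈-⊠⁻ (⊥ {m}) C x∈)))

⊠⊥ : {R : Subset m} → R ⊠ ⊥ {n} ⊆ ⊥
⊠⊥ {n = n} {R = R} x∈ = ⊥-elim (∉⊥ (proj₂ (∈-⊠⁻ R (⊥ {n}) x∈)))

⊠-∪ˡ : ∀ {R R′ : Subset m} {C : Subset n} → (R ∪ R′) ⊠ C ⊆ (R ⊠ C) ∪ (R′ ⊠ C)
⊠-∪ˡ {R = R} {R′} {C} x∈ with ∈-⊠⁻ (R ∪ R′) C x∈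
... | q∈ , r∈ with x∈p∪q⁻ R R′ q∈
...   | inj₁ q∈R = x∈p∪q⁺ (inj₁ (∈-⊠⁺ q∈R r∈))
...   | inj₂ q∈R′ = x∈p∪q⁺ (inj₂ (∈-⊠⁺ q∈R′ r∈))

⊠-∪ʳ : ∀ {R : Subset m} {C C′ : Subset n} → R ⊠ (C ∪ C′) ⊆ (R ⊠ C) ∪ (R ⊠ C′)
⊠-∪ʳ {R = R} {C} {C′} x∈ with ∈-⊠⁻ R (C ∪ C′) x∈
... | q∈ , r∈ with x∈p∪q⁻ C C′ r∈
...   | inj₁ r∈C = x∈p∪q⁺ (inj₁ (∈-⊠⁺ q∈ r∈C))
...   | inj₂ r∈C′ = x∈p∪q⁺ (inj₂ (∈-⊠⁺ q∈ r∈C′))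

image-combineˡ : (e : Fin m) (S : Subset n) → image (combine e) S ≡ ⁅ e ⁆ ⊠ S
image-combineˡ {m} {n} e S = ⊆-antisym lhs⊆rhs rhs⊆lhs
  where
  lhs⊆rhs : image (combine e) S ⊆ ⁅ e ⁆ ⊠ S
  lhs⊆rhs y∈ with ∈-image⁻ (combine e) {S} y∈
  ... | x , x∈S , refl = combine-∈-⊠⁺ (x∈⁅x⁆ e) x∈S
  rhs⊆lhs : ⁅ e ⁆ ⊠ S ⊆ image (combine e) S
  rhs⊆lhs {y} y∈ with ∈-⊠⁻ ⁅ e ⁆ S y∈
  ... | q∈⁅e⁆ , r∈S = ∈-image⁺ (combine e) r∈S
    (subst (λ i → combine i (remainder {m} n y) ≡ y) (x∈⁅y⁆⇒x≡y e q∈⁅e⁆)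
      (combine-quotient-remainder {m} n y))

image-combineʳ : (f : Fin n) (S : Subset m) → image (λ x → combine x f) S ≡ S ⊠ ⁅ f ⁆
image-combineʳ {n} {m} f S = ⊆-antisym lhs⊆rhs rhs⊆lhs
  where
  lhs⊆rhs : image (λ x → combine x f) S ⊆ S ⊠ ⁅ f ⁆
  lhs⊆rhs y∈ with ∈-image⁻ (λ x → combine {m} x f) {S} y∈
  ... | x , x∈S , refl = combine-∈-⊠⁺ x∈S (x∈⁅x⁆ f)
  rhs⊆lhs : S ⊠ ⁅ f ⁆ ⊆ image (λ x → combine x f) S
  rhs⊆lhs {y} y∈ with ∈-⊠⁻ S ⁅ f ⁆ y∈
  ... | q∈S , r∈⁅f⁆ = ∈-image⁺ (λ x → combine x f) q∈S
    (subst (λ j → combine (quotient {m} n y) j ≡ y) (x∈⁅y⁆⇒x≡y f r∈⁅f⁆)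
      (combine-quotient-remainder {m} n y))

-- id × ι on E(M) × E(C) → E(M) × E(N); ιA and ιB are its instances.
×-map₂ : ∀ m {c n} → (Fin c → Fin n) → Fin (m * c) → Fin (m * n)
×-map₂ m {c} ι x = combine (quotient {m} c x) (ι (remainder {m} c x))

×-map₂-combine : ∀ {c} (ι : Fin c → Fin n) (i : Fin m) x → ×-map₂ m ι (combine i x) ≡ combine i (ι x)
×-map₂-combine {m = m} {c} ι i x = cong (λ (i , x) → combine i (ι x)) (remQuot-combine {m} {c} i x)

∈-image-×-map₂ : ∀ {c} (ι : Fin c → Fin n) {y : Fin (m * n)} →
  remainder {m} n y ∈ image ι ⊤ → y ∈ image (×-map₂ m ι) ⊤
∈-image-×-map₂ {n = n} {m = m} ι {y} r∈ with ∈-image⁻ ι r∈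
... | z , _ , ιz≡r = ∈-image⁺ (×-map₂ m ι) ∈⊤ (begin
  ×-map₂ m ι (combine (quotient {m} n y) z)      ≡⟨ ×-map₂-combine ι (quotient {m} n y) z ⟩
  combine (quotient {m} n y) (ι z)               ≡⟨ cong (combine (quotient {m} n y)) ιz≡r ⟩
  combine (quotient {m} n y) (remainder {m} n y) ≡⟨ combine-quotient-remainder {m} n y ⟩
  y                                              ∎)
  where open ≡-Reasoning

×-map₂-cover : ∀ {c d} {ι₁ : Fin c → Fin n} {ι₂ : Fin d → Fin n} →
  ⊤ ⊆ image ι₁ ⊤ ∪ image ι₂ ⊤ → ⊤ ⊆ image (×-map₂ m ι₁) ⊤ ∪ image (×-map₂ m ι₂) ⊤
×-map₂-cover {n = n} {m = m} {ι₁ = ι₁} {ι₂} cover {y} _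
  with x∈p∪q⁻ (image ι₁ ⊤) (image ι₂ ⊤) (cover (∈⊤ {x = remainder {m} n y}))
... | inj₁ r∈ = x∈p∪q⁺ (inj₁ (∈-image-×-map₂ {m = m} ι₁ r∈))
... | inj₂ r∈ = x∈p∪q⁺ (inj₂ (∈-image-×-map₂ {m = m} ι₂ r∈))

-- Quasi products

module QuasiProduct (M : Matroid m) (N : Matroid n) (Q : Matroid (m * n))
                    (isQP : IsQuasiProduct M N Q) where

  rk-row : ∀ {e} → ¬ IsLoop M e → ∀ S → rk Q (⁅ e ⁆ ⊠ S) ≡ rk N S
  rk-row {e} nonloop S = trans (cong (rk Q) (sym (image-combineˡ e S))) (proj₁ isQP e nonloop S)

  rk-column : ∀ {f} → ¬ IsLoop N f → ∀ S → rk Q (S ⊠ ⁅ f ⁆) ≡ rk M S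
  rk-column {f} nonloop S =
    trans (cong (rk Q) (sym (image-combineʳ f S))) (proj₁ (proj₂ isQP) f nonloop S)

  rk-loop-row : ∀ {e} → IsLoop M e → rk Q (⁅ e ⁆ ⊠ ⊤) ≡ 0
  rk-loop-row {e} loop =
    trans (cong (rk Q) (sym (image-combineˡ e ⊤))) (proj₁ (proj₂ (proj₂ isQP)) e loop)

  rk-loop-column : ∀ {f} → IsLoop N f → rk Q (⊤ {m} ⊠ ⁅ f ⁆) ≡ 0
  rk-loop-column {f} loop =
    trans (cong (rk Q) (sym (image-combineʳ f ⊤))) (proj₂ (proj₂ (proj₂ isQP)) f loop)

  rk-row-≤ : ∀ e → rk Q (⁅ e ⁆ ⊠ ⊤) ≤ rank N
  rk-row-≤ e with rk M ⁅ e ⁆ ≟ℕ 0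
  ... | yes loop = ≤-trans (≤-reflexive (rk-loop-row loop)) z≤n
  ... | no nonloop = ≤-reflexive (rk-row nonloop ⊤)

  rk-column-mono : ∀ f {S T} → rk M S ≤ rk M T → rk Q (S ⊠ ⁅ f ⁆) ≤ rk Q (T ⊠ ⁅ f ⁆)
  rk-column-mono f {S} {T} S≤T with rk N ⁅ f ⁆ ≟ℕ 0
  ... | yes loop = ≤-trans (rk-⊆ Q (⊠-mono (λ _ → ∈⊤) (λ x → x)))
                           (≤-trans (≤-reflexive (rk-loop-column loop)) z≤n)
  ... | no nonloop = begin
    rk Q (S ⊠ ⁅ f ⁆)  ≡⟨ rk-column nonloop S ⟩
    rk M S            ≤⟨ S≤T ⟩
    rk M T            ≡⟨ rk-column nonloop T ⟨
    rk Q (T ⊠ ⁅ f ⁆)  ∎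
    where open ≤-Reasoning

  rk-⊠⊤-absorb : ∀ {R R′} → R ⊆ R′ → rk M R′ ≤ rk M R → rk Q (R′ ⊠ ⊤) ≤ rk Q (R ⊠ ⊤)
  rk-⊠⊤-absorb {R} {R′} R⊆R′ spanned =
    ≤-trans (rk-⊆ Q (q⊆p∪q (R ⊠ ⊤) (R′ ⊠ ⊤))) (Subset-induction Absorbed base step ⊤)
    where
    X = R ⊠ ⊤
    Absorbed : Subset n → Set
    Absorbed C = rk Q (X ∪ (R′ ⊠ C)) ≤ rk Q X
    base : Absorbed ⊥
    base = rk-⊆ Q λ x∈ → [ (λ x∈X → x∈X) , ⊥-elim ∘ ∉⊥ ∘ ⊠⊥ ]′ (x∈p∪q⁻ X _ x∈)
    step : ∀ {f C} → f ∉ C → Absorbed C → Absorbed (⁅ f ⁆ ∪ C)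
    step {f} {C} _ ih = ≤-trans (rk-⊆ Q regroup)
      (≤-trans (rk-∪-absorb Q {W = R ⊠ ⁅ f ⁆} (λ w → x∈p∪q⁺ (inj₁ (⊠-mono (λ r → r) (λ _ → ∈⊤) w)))
                                                (⊠-mono R⊆R′ (λ c → c))
                                                (rk-column-mono f spanned))
               ih)
      where
      regroup : X ∪ (R′ ⊠ (⁅ f ⁆ ∪ C)) ⊆ (X ∪ (R′ ⊠ C)) ∪ (R′ ⊠ ⁅ f ⁆)
      regroup x∈ with x∈p∪q⁻ X _ x∈
      ... | inj₁ x∈X = x∈p∪q⁺ (inj₁ (x∈p∪q⁺ (inj₁ x∈X)))
      ... | inj₂ x∈R′⊠ with x∈p∪q⁻ (R′ ⊠ ⁅ f ⁆) (R′ ⊠ C) (⊠-∪ʳ x∈R′⊠)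
      ...   | inj₁ x∈cell = x∈p∪q⁺ (inj₂ x∈cell)
      ...   | inj₂ x∈rest = x∈p∪q⁺ (inj₁ (x∈p∪q⁺ (inj₂ x∈rest)))

  rk-⊠⊤-≤ : ∀ R → rk Q (R ⊠ ⊤) ≤ rk M R * rank N
  rk-⊠⊤-≤ = Subset-induction (λ R → rk Q (R ⊠ ⊤) ≤ rk M R * rank N) base step
    where
    open ≤-Reasoning
    base : rk Q (⊥ {m} ⊠ ⊤ {n}) ≤ rk M ⊥ * rank N
    base = ≤-trans (rk-⊆ Q ⊥⊠) (≤-trans (≤-reflexive (rk-⊥ Q)) z≤n)
    step : ∀ {e R} → e ∉ R → rk Q (R ⊠ ⊤) ≤ rk M R * rank N →
      rk Q ((⁅ e ⁆ ∪ R) ⊠ ⊤) ≤ rk M (⁅ e ⁆ ∪ R) * rank N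
    step {e} {R} _ ih with rk M (⁅ e ⁆ ∪ R) ≤? rk M R
    ... | yes spanned = begin
      rk Q ((⁅ e ⁆ ∪ R) ⊠ ⊤)     ≤⟨ rk-⊠⊤-absorb (q⊆p∪q ⁅ e ⁆ R) spanned ⟩
      rk Q (R ⊠ ⊤)               ≤⟨ ih ⟩
      rk M R * rank N            ≤⟨ *-monoˡ-≤ (rank N) (rk-⊆ M (q⊆p∪q ⁅ e ⁆ R)) ⟩
      rk M (⁅ e ⁆ ∪ R) * rank N  ∎
    ... | no independent = begin
      rk Q ((⁅ e ⁆ ∪ R) ⊠ ⊤)            ≤⟨ rk-⊆ Q ⊠-∪ˡ ⟩
      rk Q ((⁅ e ⁆ ⊠ ⊤) ∪ (R ⊠ ⊤))      ≤⟨ rk-∪ Q _ _ ⟩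
      rk Q (⁅ e ⁆ ⊠ ⊤) + rk Q (R ⊠ ⊤)   ≤⟨ +-mono-≤ (rk-row-≤ e) ih ⟩
      suc (rk M R) * rank N             ≤⟨ *-monoˡ-≤ (rank N) (≰⇒> independent) ⟩
      rk M (⁅ e ⁆ ∪ R) * rank N         ∎

  rank-≤ : rank Q ≤ rank M * rank N
  rank-≤ = ≤-trans (rk-⊆ Q (⊤⊆⊤⊠⊤ m n)) (rk-⊠⊤-≤ ⊤)

restriction-isQuasiProduct : ∀ {c} {M : Matroid m} {N : Matroid n} {C : Matroid c}
  {P : Matroid (m * n)} {ι : Fin c → Fin n} →
  IsQuasiProduct M N P → IsRestrictionAlong N ι C →
  IsQuasiProduct M C (restriction P (×-map₂ m ι))
restriction-isQuasiProduct {m = m} {N = N} {C} {P} {ι} (row , column , loopRow , loopColumn) C≡N|ι =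
    (λ e nonloop S → begin-equality
      rk P (image (×-map₂ m ι) (image (combine e) S)) ≡⟨ cong (rk P) (rowImage e S) ⟩
      rk P (image (combine e) (image ι S))            ≡⟨ row e nonloop (image ι S) ⟩
      rk N (image ι S)                                ≡⟨ C≡N|ι S ⟨
      rk C S                                          ∎)
  , (λ f nonloop S → trans (cong (rk P) (columnImage f S)) (column (ι f) (nonloop ∘ trans (sym (rk-⁅ι⁆ f))) S))
  , (λ e loop → n≤0⇒n≡0 (begin
      rk P (image (×-map₂ m ι) (image (combine e) ⊤)) ≡⟨ cong (rk P) (rowImage e ⊤) ⟩
      rk P (image (combine e) (image ι ⊤))            ≤⟨ rk-⊆ P (image-mono (combine e) (λ _ → ∈⊤)) ⟩
      rk P (image (combine e) ⊤)                      ≡⟨ loopRow e loop ⟩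
      0                                               ∎))
  , (λ f loop → trans (cong (rk P) (columnImage f ⊤)) (loopColumn (ι f) (trans (rk-⁅ι⁆ f) loop)))
  where
  open ≤-Reasoning
  rk-⁅ι⁆ : ∀ f → rk N ⁅ ι f ⁆ ≡ rk C ⁅ f ⁆
  rk-⁅ι⁆ f = trans (cong (rk N) (sym (image-⁅⁆ ι f))) (sym (C≡N|ι ⁅ f ⁆))
  rowImage : ∀ e S → image (×-map₂ m ι) (image (combine e) S) ≡ image (combine e) (image ι S)
  rowImage e S = trans (image-image (×-map₂ m ι) (combine e) (×-map₂-combine ι e) S)
    (sym (image-image (combine e) ι (λ _ → refl) S))
  columnImage : ∀ f S →
    image (×-map₂ m ι) (image (λ x → combine x f) S) ≡ image (λ x → combine x (ι f)) S
  columnImage f S = image-image (×-map₂ m ι) (λ x → combine x f) (λ x → ×-map₂-combine ι x f) S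

-- Direct sums

directSum-restrictionˡ : {A : Matroid k} {B : Matroid l} {N : Matroid n}
  {ι₁ : Fin k → Fin n} {ι₂ : Fin l → Fin n} →
  Injective _≡_ _≡_ ι₁ → (∀ x y → ι₁ x ≢ ι₂ y) →
  IsDirectSumAlong N ι₁ A ι₂ B → IsRestrictionAlong N ι₁ A
directSum-restrictionˡ {A = A} {B} {N} {ι₁} {ι₂} ι₁-inj disjoint N≡A⊕B S = sym (begin
  rk N (image ι₁ S)                                               ≡⟨ N≡A⊕B (image ι₁ S) ⟩
  rk A (preimage ι₁ (image ι₁ S)) + rk B (preimage ι₂ (image ι₁ S))
    ≡⟨ cong₂ (λ S T → rk A S + rk B T) (preimage-image ι₁ ι₁-inj S) (preimage-image-disjoint ι₁ ι₂ disjoint S) ⟩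
  rk A S + rk B ⊥                                                 ≡⟨ cong (rk A S +_) (rk-⊥ B) ⟩
  rk A S + 0                                                      ≡⟨ +-identityʳ (rk A S) ⟩
  rk A S                                                          ∎)
  where open ≡-Reasoning

directSum-comm : {A : Matroid k} {B : Matroid l} {N : Matroid n}
  {ι₁ : Fin k → Fin n} {ι₂ : Fin l → Fin n} →
  IsDirectSumAlong N ι₁ A ι₂ B → IsDirectSumAlong N ι₂ B ι₁ A
directSum-comm {A = A} {B} {ι₁ = ι₁} {ι₂} N≡A⊕B S = trans (N≡A⊕B S) (+-comm (rk A (preimage ι₁ S)) _)

rank-directSum : {A : Matroid k} {B : Matroid l} {N : Matroid n}
  {ι₁ : Fin k → Fin n} {ι₂ : Fin l → Fin n} →
  IsDirectSumAlong N ι₁ A ι₂ B → rank N ≡ rank A + rank B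
rank-directSum {A = A} {B} {ι₁ = ι₁} {ι₂} N≡A⊕B =
  trans (N≡A⊕B ⊤) (cong₂ (λ S T → rk A S + rk B T) (preimage-⊤ ι₁) (preimage-⊤ ι₂))

module _ (a b : ℕ) where

  ↑-disjoint : ∀ x y → x ↑ˡ b ≢ a ↑ʳ y
  ↑-disjoint x y eq with trans (sym (splitAt-↑ˡ a x b)) (trans (cong (splitAt a) eq) (splitAt-↑ʳ a b y))
  ... | ()

  ↑-cover : ⊤ ⊆ image (_↑ˡ b) ⊤ ∪ image (a ↑ʳ_) ⊤
  ↑-cover {j} _ with splitAt a j in eq
  ... | inj₁ x = x∈p∪q⁺ (inj₁ (∈-image⁺ (_↑ˡ b) ∈⊤ (splitAt⁻¹-↑ˡ eq)))
  ... | inj₂ y = x∈p∪q⁺ (inj₂ (∈-image⁺ (a ↑ʳ_) ∈⊤ (splitAt⁻¹-↑ʳ eq)))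

module _ (P : Matroid n) (ι₁ : Fin k → Fin n) (ι₂ : Fin l → Fin n)
         (cover : ⊤ ⊆ image ι₁ ⊤ ∪ image ι₂ ⊤) where

  rank-≤-restrictions : rank P ≤ rank (restriction P ι₁) + rank (restriction P ι₂)
  rank-≤-restrictions = ≤-trans (rk-⊆ P cover) (rk-∪ P _ _)

  restrictions-directSum : rank (restriction P ι₁) + rank (restriction P ι₂) ≤ rank P →
    IsDirectSumAlong P ι₁ (restriction P ι₁) ι₂ (restriction P ι₂)
  restrictions-directSum tight S = trans (rk-separator P cover tight S)
    (cong₂ (λ S T → rk P S + rk P T) (sym (image-preimage ι₁ S)) (sym (image-preimage ι₂ S)))

mainTheorem16 : ∀ {m a b : ℕ} (M : Matroid m) (A : Matroid a) (B : Matroid b)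
    (N : Matroid (a + b)) → IsDirectSum N A B →
    (P : Matroid (m * (a + b))) → IsTensorProduct M N P →
    Σ[ PA ∈ Matroid (m * a) ] Σ[ PB ∈ Matroid (m * b) ]
    ( IsRestrictionAlong P (ιA {m} a b) PA
    × IsRestrictionAlong P (ιB {m} a b) PB
    × IsDirectSumAlong P (ιA {m} a b) PA (ιB {m} a b) PB
    × IsTensorProduct M A PA
    × IsTensorProduct M B PB )
mainTheorem16 {m} {a} {b} M A B N N≡A⊕B P (P-isQP , rank-P) =
  PA , PB , (λ _ → refl) , (λ _ → refl)
  , restrictions-directSum P ιA′ ιB′ cover (≤-reflexive (trans (cong₂ _+_ rank-PA rank-PB) rank-P-split))
  , (PA-isQP , rank-PA) , (PB-isQP , rank-PB)
  where
  ιA′ = ιA {m} a b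
  ιB′ = ιB {m} a b
  PA = restriction P ιA′
  PB = restriction P ιB′
  PA-isQP : IsQuasiProduct M A PA
  PA-isQP = restriction-isQuasiProduct {M = M} {N} {A} {P} {_↑ˡ b} P-isQP
    (directSum-restrictionˡ {A = A} {B} {N} (↑ˡ-injective b _ _) (↑-disjoint a b) N≡A⊕B)
  PB-isQP : IsQuasiProduct M B PB
  PB-isQP = restriction-isQuasiProduct {M = M} {N} {B} {P} {a ↑ʳ_} P-isQP
    (directSum-restrictionˡ {A = B} {A} {N} (↑ʳ-injective a _ _) (λ y x → ↑-disjoint a b x y ∘ sym)
      (directSum-comm {A = A} {B} {N} N≡A⊕B))
  cover : ⊤ ⊆ image ιA′ ⊤ ∪ image ιB′ ⊤
  cover = ×-map₂-cover {m = m} {ι₁ = _↑ˡ b} {ι₂ = a ↑ʳ_} (↑-cover a b)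
  rank-P-split : rank M * rank A + rank M * rank B ≡ rank P
  rank-P-split = trans (sym (*-distribˡ-+ (rank M) (rank A) (rank B)))
    (trans (cong (rank M *_) (sym (rank-directSum {A = A} {B} {N} N≡A⊕B))) (sym rank-P))
  ranks : rank PA ≡ rank M * rank A × rank PB ≡ rank M * rank B
  ranks = +-tight (QuasiProduct.rank-≤ M A PA PA-isQP) (QuasiProduct.rank-≤ M B PB PB-isQP)
                  (≤-trans (≤-reflexive rank-P-split) (rank-≤-restrictions P ιA′ ιB′ cover))
  rank-PA = proj₁ ranks
  rank-PB = proj₂ ranks
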